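{- Let $\mathfrak m$ be a PDL model, $\tau,\tau'$ trace values and $v,v'$ valuations. Let $\Pi$ be a non-empty finite set of paths in $\mathfrak m$ for $\tau$ at $v$, and $\Pi'$ a non-empty finite set of paths in $\mathfrak m$ for $\tau'$ at $v'$, and let $f:\Pi\to\Pi'$ be injective. Then: (1) if $f$ is strictly size-increasing then $\mu(\Pi)<_{DM}\mu(\Pi')$; (2) if $f$ is size-increasing then $\mu(\Pi)\le_{DM}\mu(\Pi')$.
   Context: PDL: programs $\alpha ::= a \mid \alpha;\beta \mid \alpha\cup\beta \mid \varphi? \mid \alpha^*$ over atomic programs $a$ and formulas $\varphi$, with standard Kripke semantics in a model $\mathfrak m=(S,I)$ ($I(a)\subseteq S\times S$; $;$ composition, $\cup$ union, $\varphi?$ identity on $[\![\varphi]\!]$, $*$ reflexive–transitive closure). A valuation maps labels to states. A trace value is $\tau=(x,\alpha_1\cdots\alpha_n,\beta,\varphi)$ with $x$ a label, $n\ge 0$, programs $\alpha_i,\beta$ and a formula $\varphi$. A path in $\mathfrak m$ is a sequence of states $s_1,\dots,s_m$ with $(s_i,s_{i+1})\in I(a)$ for some atomic $a$, for each $i<m$. A path for $\tau$ at $v$ is a path $s_1,\ldots,s_m$ with $s_1=v(x)$ admitting a partition, i.e. indices $k_1\le\cdots\le k_n\le m$ such that, with $k_0=1$, $(s_{k_i},s_{k_{i+1}})\in[\![\alpha_{i+1}]\!]$ for $0\le i<n$ and $(s_{k_n},s_m)\in[\![\beta^*]\!]$. The weight $|\vec s|_\tau$ of such a path is the maximum, over its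 partitions, of the length of the final segment $s_{k_n},\ldots,s_m$. For a set $\Pi$ of paths for $\tau$ at $v$, $\mu(\Pi)$ is the multiset of weights of its members. A function $f$ from paths for $\tau$ at $v$ to paths for $\tau'$ at $v'$ is size-increasing if $|\vec s|_\tau\le|f(\vec s)|_{\tau'}$ for all $\vec s$ in its domain, and strictly size-increasing if it is size-increasing and $|\vec s|_\tau<|f(\vec s)|_{\tau'}$ for at least one $\vec s$. $<_{DM}$ is the Dershowitz–Manna ordering on finite multisets of natural numbers: $M<_{DM}N$ iff $M\ne N$ and for every $y$ with $N(y)<M(y)$ there is $x>y$ with $M(x)<N(x)$, where $M(y)$ denotes multiplicity; $\le_{DM}$ is its reflexive closure. -}

module Defs where

open import Level using (0ℓ)
open import Data.Nat using (ℕ; zero; suc; _+_; _∸_; _≤_; _<_)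
open import Data.Nat.Properties using (_≟_)
open import Data.List using (List; []; _∷_; length; tabulate)
open import Data.List.Relation.Unary.Linked using (Linked)
open import Data.Fin using (Fin)
open import Data.Product using (Σ; ∃; _×_)
open import Data.Empty using (⊥)
open import Data.Sum using (_⊎_)
open import Relation.Nullary using (¬_; yes; no)
open import Relation.Binary.PropositionalEquality using (_≡_)
open import Relation.Binary.Construct.Closure.ReflexiveTransitive using (Star)

AtProg : Set
AtProg = ℕ

Atom : Set
Atom = ℕ

Label : Set
Label = ℕ

mutual
  data Prog : Set where
    at   : AtProg → Prog
    _⨾_  : Prog → Prog → Prog
    _∪_  : Prog → Prog → Prog
    _¿   : Form → Prog
    _⋆   : Prog → Prog

  data Form : Set where
    prop : Atom → Form
    ff   : Form
    _⇒_  : Form → Form → Form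
    [_]_ : Prog → Form → Form

record Model : Set₁ where
  field
    S  : Set
    I  : AtProg → S → S → Set
    IP : Atom → S → Set

module _ (𝔪 : Model) where
  open Model 𝔪

  mutual
    ⟦_⟧F : Form → S → Set
    ⟦ prop p ⟧F s  = IP p s
    ⟦ ff ⟧F s      = ⊥
    ⟦ φ ⇒ ψ ⟧F s   = ⟦ φ ⟧F s → ⟦ ψ ⟧F s
    ⟦ [ α ] φ ⟧F s = ∀ t → ⟦ α ⟧P s t → ⟦ φ ⟧F t

    ⟦_⟧P : Prog → S → S → Set
    ⟦ at a ⟧P s t   = I a s t
    ⟦ α ⨾ β ⟧P s t  = Σ S λ u → ⟦ α ⟧P s u × ⟦ β ⟧P u t
    ⟦ α ∪ β ⟧P s t  = ⟦ α ⟧P s t ⊎ ⟦ β ⟧P s t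
    ⟦ φ ¿ ⟧P s t    = (s ≡ t) × ⟦ φ ⟧F s
    ⟦ α ⋆ ⟧P s t    = Star ⟦ α ⟧P s t

  Valuation : Set
  Valuation = Label → S

  Step : S → S → Set
  Step s t = ∃ λ a → I a s t

  IsPath : List S → Set
  IsPath ss = ¬ (ss ≡ []) × Linked Step ss

  -- 1-based indexing:  ss ‼ i ↦ x  means  s_i = x  (1 ≤ i ≤ length ss)
  data _‼_↦_ : List S → ℕ → S → Set where
    here  : ∀ {x xs} → (x ∷ xs) ‼ 1 ↦ x
    there : ∀ {x xs i y} → xs ‼ i ↦ y → (x ∷ xs) ‼ suc i ↦ y

  SegRel : List S → ℕ → ℕ → (S → S → Set) → Set
  SegRel ss i j R = Σ S λ y → Σ S λ z → (ss ‼ i ↦ y) × (ss ‼ j ↦ z) × R y z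

  -- Partition ss k αs β w :
  --   starting at index k (= k_i), indices k ≤ k_{i+1} ≤ … ≤ k_n ≤ m exist such that
  --   consecutive segments are in ⟦α_{i+1}⟧ … ⟦α_n⟧, (s_{k_n}, s_m) ∈ ⟦β*⟧,
  --   and w = m - k_n + 1 is the length of the final segment s_{k_n} … s_m.
  data Partition (ss : List S) : ℕ → List Prog → Prog → ℕ → Set where
    done : ∀ {k β} → k ≤ length ss →
           SegRel ss k (length ss) ⟦ β ⋆ ⟧P →
           Partition ss k [] β (suc (length ss ∸ k))
    step : ∀ {k k' α αs β w} → k ≤ k' → k' ≤ length ss →
           SegRel ss k k' ⟦ α ⟧P →
           Partition ss k' αs β w →
           Partition ss k (α ∷ αs) β w

record TraceValue : Set where
  constructor trace
  field
    x   : Label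
    αs  : List Prog
    β   : Prog
    φ   : Form

module _ (𝔪 : Model) where
  open Model 𝔪

  PathFor : TraceValue → Valuation 𝔪 → List S → Set
  PathFor τ v ss = IsPath 𝔪 ss × _‼_↦_ 𝔪 ss 1 (v x)
                 × ∃ λ w → Partition 𝔪 ss 1 αs β w
    where open TraceValue τ

  IsWeight : TraceValue → List S → ℕ → Set
  IsWeight τ ss w = Partition 𝔪 ss 1 αs β w
                  × (∀ w' → Partition 𝔪 ss 1 αs β w' → w' ≤ w)
    where open TraceValue τ

mult : List ℕ → ℕ → ℕ
mult [] y = 0
mult (x ∷ xs) y with x ≟ y
... | yes _ = suc (mult xs y)
... | no  _ = mult xs y

_<DM_ : List ℕ → List ℕ → Set
M <DM N = ¬ (∀ y → mult M y ≡ mult N y)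
        × (∀ y → mult N y < mult M y → ∃ λ x → (y < x) × (mult M x < mult N x))

_≤DM_ : List ℕ → List ℕ → Set
M ≤DM N = M <DM N ⊎ (∀ y → mult M y ≡ mult N y)

-- μ(Π) for Π = {Π 0, …, Π (n-1)} with weights wt
μ : ∀ {n} → (Fin n → ℕ) → List ℕ
μ wt = tabulate wt

-- Only the weights and the injectivity of f matter. Write M = μ(Π) and N = μ(Π').
-- Since f is injective and never decreases weights, for every threshold y the
-- multiset M has at most as many elements ≥ y as N, and strictly fewer at
-- y = wt' (f i) when wt i < wt' (f i). Such dominance of all upper counts already
-- gives the Dershowitz–Manna comparison: if N(y) < M(y) but no x > y had
-- M(x) < N(x), then N(x) ≤ M(x) for all x > y, and M would have more elements ≥ y than N.
module Submission where

open import Defs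
open import Data.Nat using (ℕ; zero; suc; _+_; _≤_; _<_; z≤n; s≤s; _≤?_; _<?_)
open import Data.Nat.Properties
open import Data.Fin using (Fin; punchIn; punchOut) renaming (zero to fzero; suc to fsuc)
open import Data.Fin.Properties using (punchIn-injective; punchInᵢ≢i; punchOut-injective; punchIn-punchOut)
open import Data.List using (List; []; _∷_; map; tabulate)
open import Data.Nat.ListAction using (sum)
open import Data.Product using (∃; _×_; _,_)
open import Data.Sum using (_⊎_; inj₁; inj₂)
open import Function using (_∘_)
open import Function.Definitions using (Injective)
open import Relation.Nullary using (¬_; yes; no; contradiction)
open import Relation.Binary.PropositionalEquality
open import Algebra.Properties.CommutativeMonoid.Sum +-0-commutativeMonoid
  using (sum-remove) renaming (sum to ∑)
open import Algebra.Properties.CommutativeSemigroup +-commutativeSemigroup using (x∙yz≈y∙xz)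

private
  variable
    m n : ℕ

record Restriction (f : Fin (suc m) → Fin (suc n)) (i : Fin (suc m)) : Set where
  field
    f′        : Fin m → Fin n
    injective : Injective _≡_ _≡_ f′
    commutes  : ∀ j → punchIn (f i) (f′ j) ≡ f (punchIn i j)

restrict : (f : Fin (suc m) → Fin (suc n)) → Injective _≡_ _≡_ f →
           (i : Fin (suc m)) → Restriction f i
restrict f f-inj i = record
  { f′        = λ j → punchOut (distinct j)
  ; injective = λ {j} {k} eq →
      punchIn-injective i j k (f-inj (punchOut-injective (distinct j) (distinct k) eq))
  ; commutes  = λ j → punchIn-punchOut (distinct j)
  }
  where
  distinct : ∀ j → f i ≢ f (punchIn i j)
  distinct j eq = punchInᵢ≢i i j (sym (f-inj eq))

mutual
  ∑-≤-injection : (a : Fin m → ℕ) (b : Fin n → ℕ) (f : Fin m → Fin n) →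
                  Injective _≡_ _≡_ f → (∀ i → a i ≤ b (f i)) → ∑ a ≤ ∑ b
  ∑-≤-injection {zero}          a b f f-inj a≤bf = z≤n
  ∑-≤-injection {suc m} {zero}  a b f f-inj a≤bf with f fzero
  ... | ()
  ∑-≤-injection {suc m} {suc n} a b f f-inj a≤bf = begin
    ∑ a                                              ≡⟨ sum-remove {i = fzero} a ⟩
    a fzero + ∑ (a ∘ punchIn fzero)                  ≤⟨ +-mono-≤ (a≤bf fzero) (∑-punchIn-≤-injection a b f f-inj a≤bf fzero) ⟩
    b (f fzero) + ∑ (b ∘ punchIn (f fzero))          ≡⟨ sum-remove {i = f fzero} b ⟨
    ∑ b                                              ∎
    where open ≤-Reasoning

  ∑-punchIn-≤-injection : (a : Fin (suc m) → ℕ) (b : Fin (suc n) → ℕ)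
                          (f : Fin (suc m) → Fin (suc n)) → Injective _≡_ _≡_ f →
                          (∀ i → a i ≤ b (f i)) →
                          ∀ i → ∑ (a ∘ punchIn i) ≤ ∑ (b ∘ punchIn (f i))
  ∑-punchIn-≤-injection a b f f-inj a≤bf i =
    ∑-≤-injection (a ∘ punchIn i) (b ∘ punchIn (f i)) f′ injective
      (λ j → subst (λ k → a (punchIn i j) ≤ b k) (sym (commutes j)) (a≤bf (punchIn i j)))
    where open Restriction (restrict f f-inj i)

∑-<-injection : (a : Fin m → ℕ) (b : Fin n → ℕ) (f : Fin m → Fin n) →
                Injective _≡_ _≡_ f → (∀ i → a i ≤ b (f i)) →
                ∃ (λ i → a i < b (f i)) → ∑ a < ∑ b
∑-<-injection {suc m} {zero}  a b f f-inj a≤bf (i , _) with f i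
... | ()
∑-<-injection {suc m} {suc n} a b f f-inj a≤bf (i , ai<bfi) = begin-strict
  ∑ a                                      ≡⟨ sum-remove {i = i} a ⟩
  a i + ∑ (a ∘ punchIn i)                  <⟨ +-mono-<-≤ ai<bfi (∑-punchIn-≤-injection a b f f-inj a≤bf i) ⟩
  b (f i) + ∑ (b ∘ punchIn (f i))          ≡⟨ sum-remove {i = f i} b ⟨
  ∑ b                                      ∎
  where open ≤-Reasoning

indicator≤ : ℕ → ℕ → ℕ
indicator≤ y x with y ≤? x
... | yes _ = 1
... | no  _ = 0

indicator≤-yes : ∀ {y x} → y ≤ x → indicator≤ y x ≡ 1
indicator≤-yes {y} {x} y≤x with y ≤? x
... | yes _   = refl
... | no  y≰x = contradiction y≤x y≰x

indicator≤-no : ∀ {y x} → x < y → indicator≤ y x ≡ 0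
indicator≤-no {y} {x} x<y with y ≤? x
... | yes y≤x = contradiction y≤x (<⇒≱ x<y)
... | no  _   = refl

indicator≤-mono : ∀ y {x x′} → x ≤ x′ → indicator≤ y x ≤ indicator≤ y x′
indicator≤-mono y {x} x≤x′ with y ≤? x
... | yes y≤x = ≤-reflexive (sym (indicator≤-yes (≤-trans y≤x x≤x′)))
... | no  _   = z≤n

indicator≤-suc : ∀ y x → x ≢ y → indicator≤ y x ≡ indicator≤ (suc y) x
indicator≤-suc y x x≢y with y ≤? x
... | yes y≤x = sym (indicator≤-yes (≤∧≢⇒< y≤x (x≢y ∘ sym)))
... | no  y≰x = sym (indicator≤-no (≤-trans (≰⇒> y≰x) (n≤1+n y)))

countAtLeast : ℕ → List ℕ → ℕ
countAtLeast y xs = sum (map (indicator≤ y) xs)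

countAtLeast-tabulate : ∀ y (g : Fin n → ℕ) →
                        countAtLeast y (tabulate g) ≡ ∑ (indicator≤ y ∘ g)
countAtLeast-tabulate {zero}  y g = refl
countAtLeast-tabulate {suc n} y g =
  cong (indicator≤ y (g fzero) +_) (countAtLeast-tabulate y (g ∘ fsuc))

countAtLeast-mult : ∀ y xs → countAtLeast y xs ≡ mult xs y + countAtLeast (suc y) xs
countAtLeast-mult y [] = refl
countAtLeast-mult y (x ∷ xs) with x ≟ y
... | yes refl rewrite indicator≤-yes (≤-refl {x}) | indicator≤-no (n<1+n x) =
  cong suc (countAtLeast-mult x xs)
... | no  x≢y  rewrite indicator≤-suc y x x≢y =
  trans (cong (indicator≤ (suc y) x +_) (countAtLeast-mult y xs))
        (x∙yz≈y∙xz (indicator≤ (suc y) x) (mult xs y) (countAtLeast (suc y) xs))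

mult-above-sum : ∀ xs {y} → sum xs < y → mult xs y ≡ 0
mult-above-sum []       _ = refl
mult-above-sum (x ∷ xs) {y} sum<y with x ≟ y
... | yes refl = contradiction (≤-<-trans (m≤m+n x (sum xs)) sum<y) (<-irrefl refl)
... | no  _    = mult-above-sum xs (≤-<-trans (m≤n+m (sum xs) x) sum<y)

countAtLeast-above-sum : ∀ xs {y} → sum xs < y → countAtLeast y xs ≡ 0
countAtLeast-above-sum []       _ = refl
countAtLeast-above-sum (x ∷ xs) sum<y
  rewrite indicator≤-no (≤-<-trans (m≤m+n x (sum xs)) sum<y) =
  countAtLeast-above-sum xs (≤-<-trans (m≤n+m (sum xs) x) sum<y)

downward-induction : ∀ {ℓ} (P : ℕ → Set ℓ) (b : ℕ) →
                     (∀ y → b < y → P y) → (∀ y → P (suc y) → P y) → ∀ y → P y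
downward-induction P b above descend y = go (suc b) y (m≤n+m (suc b) y)
  where
  go : ∀ k y → b < y + k → P y
  go zero    y b<y   = above y (subst (b <_) (+-identityʳ y) b<y)
  go (suc k) y b<y+k = descend y (go k (suc y) (subst (b <_) (+-suc y k) b<y+k))

MultBoundedFrom : ℕ → List ℕ → List ℕ → Set
MultBoundedFrom y xs ys = ∀ x → y ≤ x → mult xs x ≤ mult ys x

multBoundedFrom? : ∀ y xs ys →
                   (∃ λ x → y ≤ x × mult ys x < mult xs x) ⊎ MultBoundedFrom y xs ys
multBoundedFrom? y xs ys = downward-induction P (sum xs) above descend y
  where
  P : ℕ → Set
  P y = (∃ λ x → y ≤ x × mult ys x < mult xs x) ⊎ MultBoundedFrom y xs ys

  above : ∀ y → sum xs < y → P y
  above y sum<y = inj₂ λ x y≤x → subst (_≤ _) (sym (mult-above-sum xs (<-≤-trans sum<y y≤x))) z≤n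

  descend : ∀ y → P (suc y) → P y
  descend y (inj₁ (x , y<x , gap)) = inj₁ (x , <⇒≤ y<x , gap)
  descend y (inj₂ bounded) with mult ys y <? mult xs y
  ... | yes gap   = inj₁ (y , ≤-refl , gap)
  ... | no  ¬gap  = inj₂ bounded′
    where
    bounded′ : MultBoundedFrom y xs ys
    bounded′ x y≤x with m≤n⇒m<n∨m≡n y≤x
    ... | inj₁ y<x  = bounded x y<x
    ... | inj₂ refl = ≮⇒≥ ¬gap

countAtLeast-mono : ∀ y xs ys → MultBoundedFrom y xs ys → countAtLeast y xs ≤ countAtLeast y ys
countAtLeast-mono y xs ys = downward-induction P (sum xs) above descend y
  where
  P : ℕ → Set
  P y = MultBoundedFrom y xs ys → countAtLeast y xs ≤ countAtLeast y ys

  above : ∀ y → sum xs < y → P y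
  above y sum<y _ = subst (_≤ _) (sym (countAtLeast-above-sum xs sum<y)) z≤n

  descend : ∀ y → P (suc y) → P y
  descend y ih bounded = begin
    countAtLeast y xs                           ≡⟨ countAtLeast-mult y xs ⟩
    mult xs y + countAtLeast (suc y) xs         ≤⟨ +-mono-≤ (bounded y ≤-refl) (ih λ x y<x → bounded x (<⇒≤ y<x)) ⟩
    mult ys y + countAtLeast (suc y) ys         ≡⟨ countAtLeast-mult y ys ⟨
    countAtLeast y ys                           ∎
    where open ≤-Reasoning

countAtLeast-≤-injection : (g : Fin m → ℕ) (h : Fin n → ℕ) (f : Fin m → Fin n) →
                           Injective _≡_ _≡_ f → (∀ i → g i ≤ h (f i)) →
                           ∀ y → countAtLeast y (tabulate g) ≤ countAtLeast y (tabulate h)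
countAtLeast-≤-injection g h f f-inj g≤hf y
  rewrite countAtLeast-tabulate y g | countAtLeast-tabulate y h =
  ∑-≤-injection (indicator≤ y ∘ g) (indicator≤ y ∘ h) f f-inj (indicator≤-mono y ∘ g≤hf)

countAtLeast-<-injection : (g : Fin m → ℕ) (h : Fin n → ℕ) (f : Fin m → Fin n) →
                           Injective _≡_ _≡_ f → (∀ i → g i ≤ h (f i)) →
                           ∀ i → g i < h (f i) →
                           countAtLeast (h (f i)) (tabulate g) < countAtLeast (h (f i)) (tabulate h)
countAtLeast-<-injection g h f f-inj g≤hf i gi<hfi
  rewrite countAtLeast-tabulate (h (f i)) g | countAtLeast-tabulate (h (f i)) h =
  ∑-<-injection (indicator≤ y ∘ g) (indicator≤ y ∘ h) f f-inj (indicator≤-mono y ∘ g≤hf)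
    (i , subst₂ _<_ (sym (indicator≤-no gi<hfi)) (sym (indicator≤-yes ≤-refl)) (s≤s z≤n))
  where y = h (f i)

module _ (M N : List ℕ) (counts≤ : ∀ y → countAtLeast y M ≤ countAtLeast y N) where

  countAtLeast-≤⇒DM : ∀ y → mult N y < mult M y → ∃ λ x → y < x × mult M x < mult N x
  countAtLeast-≤⇒DM y N<M with multBoundedFrom? (suc y) N M
  ... | inj₁ gap     = gap
  ... | inj₂ bounded = contradiction (counts≤ y) (<⇒≱ (begin-strict
    countAtLeast y N                        ≡⟨ countAtLeast-mult y N ⟩
    mult N y + countAtLeast (suc y) N       <⟨ +-mono-<-≤ N<M (countAtLeast-mono (suc y) N M bounded) ⟩
    mult M y + countAtLeast (suc y) M       ≡⟨ countAtLeast-mult y M ⟨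
    countAtLeast y M                        ∎))
    where open ≤-Reasoning

  countAtLeast-<⇒<DM : ∀ y → countAtLeast y M < countAtLeast y N → M <DM N
  countAtLeast-<⇒<DM y counts< = distinct , countAtLeast-≤⇒DM
    where
    distinct : ¬ (∀ x → mult M x ≡ mult N x)
    distinct same = <⇒≱ counts< (countAtLeast-mono y N M λ x _ → ≤-reflexive (sym (same x)))

  countAtLeast-≤⇒≤DM : M ≤DM N
  countAtLeast-≤⇒≤DM with multBoundedFrom? 0 M N | multBoundedFrom? 0 N M
  ... | inj₁ (x , _ , N<M) | _ = inj₁ ((λ same → <-irrefl (sym (same x)) N<M) , countAtLeast-≤⇒DM)
  ... | inj₂ _ | inj₁ (x , _ , M<N) = inj₁ ((λ same → <-irrefl (same x) M<N) , countAtLeast-≤⇒DM)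
  ... | inj₂ M≤N | inj₂ N≤M = inj₂ λ y → ≤-antisym (M≤N y z≤n) (N≤M y z≤n)

proposition1 : (𝔪 : Model) (τ τ' : TraceValue) (v v' : Valuation 𝔪)
    (n n' : ℕ) (Π : Fin n → List (Model.S 𝔪)) (Π' : Fin n' → List (Model.S 𝔪)) →
    0 < n → 0 < n' → Injective _≡_ _≡_ Π → Injective _≡_ _≡_ Π' →
    (∀ i → PathFor 𝔪 τ v (Π i)) → (∀ j → PathFor 𝔪 τ' v' (Π' j)) →
    (wt : Fin n → ℕ) (wt' : Fin n' → ℕ) →
    (∀ i → IsWeight 𝔪 τ (Π i) (wt i)) → (∀ j → IsWeight 𝔪 τ' (Π' j) (wt' j)) →
    (f : Fin n → Fin n') → Injective _≡_ _≡_ f →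
    (((∀ i → wt i ≤ wt' (f i)) × (∃ λ i → wt i < wt' (f i))) → μ wt <DM μ wt')
    × ((∀ i → wt i ≤ wt' (f i)) → μ wt ≤DM μ wt')
proposition1 𝔪 τ τ' v v' n n' Π Π' _ _ _ _ _ _ wt wt' _ _ f f-inj = strict , weak
  where
  strict : ((∀ i → wt i ≤ wt' (f i)) × (∃ λ i → wt i < wt' (f i))) → μ wt <DM μ wt'
  strict (wt≤ , i , wt<) =
    countAtLeast-<⇒<DM (μ wt) (μ wt') (countAtLeast-≤-injection wt wt' f f-inj wt≤)
      (wt' (f i)) (countAtLeast-<-injection wt wt' f f-inj wt≤ i wt<)

  weak : (∀ i → wt i ≤ wt' (f i)) → μ wt ≤DM μ wt'
  weak wt≤ = countAtLeast-≤⇒≤DM (μ wt) (μ wt') (countAtLeast-≤-injection wt wt' f f-inj wt≤)
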